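{- Let $n=p_1^{n_1}\cdots p_r^{n_r}$ with primes $p_1<\cdots<p_r$, positive integers $n_i$, and $r\geq 3$. Let $a,b\in[r]$ with $a\neq b$ and $p_b>2$. If $T$ is the union of the $r-2$ subgroups $S_{n/(p_bp_j)}$ of $C_n$ with $j\in[r]\setminus\{a,b\}$, then $|E_{n/p_a}|+|T|>|Q_r^1|$.
   Context: $C_n$ is the cyclic group of order $n$; $[m]=\{1,\dots,m\}$. For a divisor $d$ of $n$, $E_d$ is the set of elements of $C_n$ of order $d$ and $S_d$ is the unique subgroup of order $d$. $Q_r^1$ is the union of the subgroups $S_{n/(p_ip_r)}$ over $i\in[r-1]$. -}

module Defs where

open import Data.Nat using (ℕ; zero; suc; _*_; _^_; _≟_)
open import Data.Nat.DivMod using (_/_)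
open import Data.Nat.Divisibility using (_∣_; _∣?_)
open import Data.Bool using (Bool; if_then_else_; not; _∧_)
open import Data.Fin using (Fin; toℕ)
open import Data.Nat.ListAction using (product)
open import Data.List using (List; map; upTo; length; filter; filterᵇ; allFin)
open import Data.List.Relation.Unary.Any using (Any; any?)
open import Relation.Nullary using (Dec; does)
open import Relation.Unary using (Decidable)
open import Relation.Binary.PropositionalEquality using (_≡_)

range : ℕ → List ℕ
range m = map suc (upTo m)

prodRange : ℕ → (ℕ → ℕ) → ℕ
prodRange r f = product (map f (range r))

-- truncated division (only used with a nonzero divisor)
_div_ : ℕ → ℕ → ℕ
n div zero = zero
n div suc m = n / suc m

-- C_n is modelled as ℤ/nℤ with elements Fin n (additive).
-- least k ∈ {s, …, s+fuel-1} with P k (or s+fuel if none)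
least : ℕ → ℕ → (ℕ → Bool) → ℕ
least zero s P = s
least (suc f) s P = if P s then s else least f (suc s) P

-- order of x in C_n: least k ≥ 1 with k·x = 0 in ℤ/nℤ (always ≤ n)
ord : (n : ℕ) → Fin n → ℕ
ord n x = least n 1 (λ k → does (n ∣? (k * toℕ x)))

E : (n d : ℕ) → Fin n → Set
E n d x = ord n x ≡ d

E? : (n d : ℕ) → Decidable (E n d)
E? n d x = ord n x ≟ d

-- x ∈ S_d (for d ∣ n, S_d = {x : d·x = 0} is the unique subgroup of order d)
InS : (n d : ℕ) → Fin n → Set
InS n d x = n ∣ d * toℕ x

InUnion : (n : ℕ) → List ℕ → Fin n → Set
InUnion n ds x = Any (λ d → InS n d x) ds

InUnion? : (n : ℕ) (ds : List ℕ) → Decidable (InUnion n ds)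
InUnion? n ds x = any? (λ d → n ∣? (d * toℕ x)) ds

card : (n : ℕ) {P : Fin n → Set} → Decidable P → ℕ
card n P? = length (filter P? (allFin n))

Tlist : (n r : ℕ) (p : ℕ → ℕ) (a b : ℕ) → List ℕ
Tlist n r p a b =
  map (λ j → n div (p b * p j))
      (filterᵇ (λ j → not (does (j ≟ a)) ∧ not (does (j ≟ b))) (range r))

Qlist : (n r : ℕ) (p : ℕ → ℕ) → List ℕ
Qlist n r p = map (λ i → n div (p i * p r)) (range (r Data.Nat.∸ 1))

-- Write n = K · ∏ p_i with K = ∏ p_i ^ (e_i - 1). In C_n = ℤ/nℤ an element y lies in S_{n/(p_i p_j)}
-- exactly when p_i p_j ∣ y, so Q_r^1 consists of the multiples of p_r with another prime factor p_i, T
-- of the multiples of p_b with a prime factor p_j (j ∉ {a, b}), and E_{n/p_a} contains every p_a z with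
-- z prime to n/p_a. Sieving out one prime at a time, in product form, gives
--   |Q_r^1| ≤ K (∏_{i≠r} p_i − ∏_{i≠r} (p_i − 1)),   |T| ≥ K p_a (∏_{j≠a,b} p_j − ∏_{j≠a,b} (p_j − 1)),
--   p_a |E_{n/p_a}| ≥ φ(n) = K ∏ (p_i − 1).
-- After multiplying by p_a and dividing by K, what is left is a polynomial inequality in the primes,
-- checked separately for a = r, b = r and a, b ≠ r; it needs p_r ≥ 4 and, when a = r, p_b ≥ 3.
module Submission where

open import Data.Bool using (Bool; true; false; not; _∧_; if_then_else_; T?)
open import Data.Bool.Properties using (T-≡; ∧-comm; ∧-identityʳ; ∧-zeroʳ; ∧-inverseʳ)
open import Data.Fin using (Fin; toℕ)
import Data.Fin as Fin
open import Data.List using ([_]; _++_; length; filter; filterᵇ; map; tabulate; upTo)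
open import Data.List.Membership.Propositional using (_∈_; find; lose)
open import Data.List.Membership.Propositional.Properties using (∈-upTo⁺; ∈-upTo⁻; ∈-map⁺; ∈-filter⁺)
open import Data.List.Properties using (upTo-∷ʳ; map-++)
import Data.List.Relation.Unary.Any.Properties as Any
open import Data.Nat
open import Data.Nat.Coprimality using (Coprime; coprime-divisor; 1-coprimeTo)
open import Data.Nat.DivMod using (m*n/n≡m)
open import Data.Nat.Divisibility
open import Data.Nat.ListAction using (product)
open import Data.Nat.ListAction.Properties using (product-++)
open import Data.Nat.Primality using (Prime; euclidsLemma; prime⇒irreducible; prime⇒nonZero; prime⇒nonTrivial)
open import Data.Nat.Properties
open import Algebra.Properties.CommutativeSemigroup *-commutativeSemigroup using (interchange; x∙yz≈y∙xz; x∙yz≈yx∙z)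
open import Data.Nat.Tactic.RingSolver using (solve-∀)
open import Data.Product using (∃; _×_; _,_)
open import Data.Sum using (inj₁; inj₂)
open import Function using (_∘_)
open import Function.Bundles using (_⇔_; mk⇔; Equivalence)
open import Relation.Binary using (tri<; tri≈; tri>)
open import Relation.Binary.PropositionalEquality hiding ([_])
open import Relation.Nullary using (¬_; yes; no; does; contradiction)
open import Relation.Nullary.Decidable using (dec-true; dec-false; does-⇔)
open import Relation.Unary using (Decidable)
open import Defs

-- Counting on initial segments of ℕ

bit : Bool → ℕ
bit true = 1
bit false = 0

count : (ℕ → Bool) → ℕ → ℕ
count P zero = 0
count P (suc m) = bit (P 0) + count (P ∘ suc) m

count-cong : ∀ {P Q} → (∀ y → P y ≡ Q y) → ∀ m → count P m ≡ count Q m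
count-cong P≗Q zero = refl
count-cong P≗Q (suc m) = cong₂ _+_ (cong bit (P≗Q 0)) (count-cong (P≗Q ∘ suc) m)

count-none : ∀ {P} m → (∀ y → y < m → P y ≡ false) → count P m ≡ 0
count-none zero _ = refl
count-none (suc m) none rewrite none 0 z<s = count-none m (λ y y<m → none (suc y) (s<s y<m))

count-all : ∀ m → count (λ _ → true) m ≡ m
count-all zero = refl
count-all (suc m) = cong suc (count-all m)

count-+ : ∀ P m k → count P (m + k) ≡ count P m + count (λ y → P (m + y)) k
count-+ P zero k = refl
count-+ P (suc m) k = trans (cong (bit (P 0) +_) (count-+ (P ∘ suc) m k)) (sym (+-assoc (bit (P 0)) _ _))

count-complement : ∀ P m → count P m + count (not ∘ P) m ≡ m
count-complement P zero = refl
count-complement P (suc m) with P 0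
... | true = cong suc (count-complement (P ∘ suc) m)
... | false = trans (+-suc (count (P ∘ suc) m) _) (cong suc (count-complement (P ∘ suc) m))

count-split : ∀ (P H : ℕ → Bool) m → count (λ y → P y ∧ not (H y)) m + count (λ y → P y ∧ H y) m ≡ count P m
count-split P H zero = refl
count-split P H (suc m) with P 0 | H 0
... | false | _ = count-split (P ∘ suc) (H ∘ suc) m
... | true | false = cong suc (count-split (P ∘ suc) (H ∘ suc) m)
... | true | true = trans (+-suc _ _) (cong suc (count-split (P ∘ suc) (H ∘ suc) m))

_∣ᵇ_ : ℕ → ℕ → Bool
q ∣ᵇ y = does (q ∣? y)

∣ᵇ-+-self : ∀ q y → q ∣ᵇ (q + y) ≡ q ∣ᵇ y
∣ᵇ-+-self q y =
  does-⇔ (mk⇔ (λ q∣q+y → ∣m+n∣m⇒∣n q∣q+y ∣-refl) (∣m∣n⇒∣m+n ∣-refl)) (q ∣? (q + y)) (q ∣? y)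

-- Among 0, …, q − 1 only 0 is a multiple of q.
count-multiples-below : ∀ q .{{_ : NonZero q}} (F : ℕ → Bool) → count (λ y → q ∣ᵇ y ∧ F y) q ≡ bit (F 0)
count-multiples-below (suc q′) F = begin
  bit (suc q′ ∣ᵇ 0 ∧ F 0) + count (λ y → suc q′ ∣ᵇ suc y ∧ F (suc y)) q′
    ≡⟨ cong₂ _+_ (cong (λ d → bit (d ∧ F 0)) (dec-true (suc q′ ∣? 0) (suc q′ ∣0))) (count-none q′ none) ⟩
  bit (F 0) + 0
    ≡⟨ +-identityʳ _ ⟩
  bit (F 0) ∎
  where
  open ≡-Reasoning
  none : ∀ y → y < q′ → suc q′ ∣ᵇ suc y ∧ F (suc y) ≡ false
  none y y<q′ = cong (_∧ F (suc y)) (dec-false (suc q′ ∣? suc y) (λ d → <⇒≱ (s<s y<q′) (∣⇒≤ d)))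

count-multiples : ∀ q .{{_ : NonZero q}} (F : ℕ → Bool) X →
  count (λ y → q ∣ᵇ y ∧ F y) (q * X) ≡ count (λ z → F (q * z)) X
count-multiples q F zero = cong (count _) (*-zeroʳ q)
count-multiples q F (suc X) = begin
  count M (q * suc X)                                  ≡⟨ cong (count M) (*-suc q X) ⟩
  count M (q + q * X)                                  ≡⟨ count-+ M q (q * X) ⟩
  count M q + count (λ y → M (q + y)) (q * X)          ≡⟨ cong₂ _+_ (count-multiples-below q F)
                                                                    (count-cong shift (q * X)) ⟩
  bit (F 0) + count (λ y → q ∣ᵇ y ∧ F (q + y)) (q * X) ≡⟨ cong₂ _+_ (cong (bit ∘ F) (sym (*-zeroʳ q)))
                                                                    (count-multiples q (λ y → F (q + y)) X) ⟩
  bit (F (q * 0)) + count (λ z → F (q + q * z)) X      ≡⟨ cong (bit (F (q * 0)) +_)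
                                                               (count-cong (λ z → cong F (*-suc q z)) X) ⟨
  count (λ z → F (q * z)) (suc X)                      ∎
  where
  open ≡-Reasoning
  M : ℕ → Bool
  M y = q ∣ᵇ y ∧ F y
  shift : ∀ y → M (q + y) ≡ q ∣ᵇ y ∧ F (q + y)
  shift y = cong (_∧ F (q + y)) (∣ᵇ-+-self q y)

-- Since allFin n = tabulate id, these compare card n P? with count Q n.
module _ {m} {P : Fin m → Set} (P? : Decidable P) where

  filter-tabulate-≤-count : ∀ {n} (g : Fin n → Fin m) Q → (∀ i → P (g i) → Q (toℕ i) ≡ true) →
    length (filter P? (tabulate g)) ≤ count Q n
  filter-tabulate-≤-count {zero} g Q P⇒Q = z≤n
  filter-tabulate-≤-count {suc n} g Q P⇒Q with P? (g Fin.zero)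
  ... | yes Pg rewrite P⇒Q Fin.zero Pg = s≤s (filter-tabulate-≤-count (g ∘ Fin.suc) (Q ∘ suc) (P⇒Q ∘ Fin.suc))
  ... | no _ = ≤-trans (filter-tabulate-≤-count (g ∘ Fin.suc) (Q ∘ suc) (P⇒Q ∘ Fin.suc)) (m≤n+m _ _)

  count-≤-filter-tabulate : ∀ {n} (g : Fin n → Fin m) Q → (∀ i → Q (toℕ i) ≡ true → P (g i)) →
    count Q n ≤ length (filter P? (tabulate g))
  count-≤-filter-tabulate {zero} g Q Q⇒P = z≤n
  count-≤-filter-tabulate {suc n} g Q Q⇒P with Q 0 in Q0 | P? (g Fin.zero)
  ... | true | yes _ = s≤s (count-≤-filter-tabulate (g ∘ Fin.suc) (Q ∘ suc) (Q⇒P ∘ Fin.suc))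
  ... | true | no ¬Pg = contradiction (Q⇒P Fin.zero Q0) ¬Pg
  ... | false | yes _ = m≤n⇒m≤1+n (count-≤-filter-tabulate (g ∘ Fin.suc) (Q ∘ suc) (Q⇒P ∘ Fin.suc))
  ... | false | no _ = count-≤-filter-tabulate (g ∘ Fin.suc) (Q ∘ suc) (Q⇒P ∘ Fin.suc)

-- Finite products and index sets

AllUpTo : ℕ → (ℕ → Set) → Set
AllUpTo r P = ∀ i → 1 ≤ i → i ≤ r → P i

AllUpTo-pred : ∀ {r P} → AllUpTo (suc r) P → AllUpTo r P
AllUpTo-pred h i 1≤i i≤r = h i 1≤i (m≤n⇒m≤1+n i≤r)

prod : ℕ → (ℕ → ℕ) → ℕ
prod zero f = 1
prod (suc r) f = prod r f * f (suc r)

prodRange≡prod : ∀ r f → prodRange r f ≡ prod r f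
prodRange≡prod zero f = refl
prodRange≡prod (suc r) f = begin
  product (map f (map suc (upTo (suc r))))            ≡⟨ cong (λ is → product (map f (map suc is))) (upTo-∷ʳ r) ⟨
  product (map f (map suc (upTo r ++ [ r ])))         ≡⟨ cong (product ∘ map f) (map-++ suc (upTo r) [ r ]) ⟩
  product (map f (map suc (upTo r) ++ [ suc r ]))     ≡⟨ cong product (map-++ f (map suc (upTo r)) [ suc r ]) ⟩
  product (map f (map suc (upTo r)) ++ [ f (suc r) ]) ≡⟨ product-++ (map f (map suc (upTo r))) [ f (suc r) ] ⟩
  prodRange r f * (f (suc r) * 1)                     ≡⟨ cong₂ _*_ (prodRange≡prod r f) (*-identityʳ (f (suc r))) ⟩
  prod r f * f (suc r)                                ∎
  where open ≡-Reasoning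

prod-cong : ∀ r {f g} → AllUpTo r (λ i → f i ≡ g i) → prod r f ≡ prod r g
prod-cong zero f≗g = refl
prod-cong (suc r) f≗g = cong₂ _*_ (prod-cong r (AllUpTo-pred f≗g)) (f≗g (suc r) (s≤s z≤n) ≤-refl)

prod-* : ∀ r f g → prod r (λ i → f i * g i) ≡ prod r f * prod r g
prod-* zero f g = refl
prod-* (suc r) f g rewrite prod-* r f g = interchange (prod r f) (prod r g) (f (suc r)) (g (suc r))

prod-split : ∀ r {f} g h → AllUpTo r (λ i → f i ≡ g i * h i) → prod r f ≡ prod r g * prod r h
prod-split r g h f≗g*h = trans (prod-cong r f≗g*h) (prod-* r g h)

prod-mono-≤ : ∀ r {f g} → AllUpTo r (λ i → f i ≤ g i) → prod r f ≤ prod r g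
prod-mono-≤ zero f≤g = ≤-refl
prod-mono-≤ (suc r) f≤g = *-mono-≤ (prod-mono-≤ r (AllUpTo-pred f≤g)) (f≤g (suc r) (s≤s z≤n) ≤-refl)

prod-nonZero : ∀ r {f} → AllUpTo r (λ i → NonZero (f i)) → NonZero (prod r f)
prod-nonZero zero f≢0 = _
prod-nonZero (suc r) f≢0 = m*n≢0 _ _ {{prod-nonZero r (AllUpTo-pred f≢0)}} {{f≢0 (suc r) (s≤s z≤n) ≤-refl}}

∣-prod : ∀ r f {i} → 1 ≤ i → i ≤ r → f i ∣ prod r f
∣-prod zero f 1≤i i≤0 = contradiction (≤-trans 1≤i i≤0) λ ()
∣-prod (suc r) f {i} 1≤i i≤1+r with i ≟ suc r
... | yes refl = n∣m*n (prod r f)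
... | no i≢1+r = ∣m⇒∣m*n (f (suc r)) (∣-prod r f 1≤i (≤-pred (≤∧≢⇒< i≤1+r i≢1+r)))

-- Index sets are Boolean selectors s; prod r (f ↾ s) is the product of f over the indices s selects.
full : ℕ → Bool
full _ = true

infixl 6 _∖_
_∖_ : (ℕ → Bool) → ℕ → (ℕ → Bool)
(s ∖ c) i = s i ∧ not (does (i ≟ c))

only : ℕ → ℕ → Bool
only c i = does (i ≟ c)

∖-self : ∀ s c → (s ∖ c) c ≡ false
∖-self s c = trans (cong (λ d → s c ∧ not d) (dec-true (c ≟ c) refl)) (∧-zeroʳ (s c))

∖-≢ : ∀ s {c i} → i ≢ c → (s ∖ c) i ≡ s i
∖-≢ s {c} {i} i≢c = trans (cong (λ d → s i ∧ not d) (dec-false (i ≟ c) i≢c)) (∧-identityʳ (s i))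

∖-selected : ∀ s {c i} → s i ≡ true → i ≢ c → (s ∖ c) i ≡ true
∖-selected s si i≢c = trans (∖-≢ s i≢c) si

∖-selected⇒≢ : ∀ s c {i} → (s ∖ c) i ≡ true → i ≢ c
∖-selected⇒≢ s c selected refl = contradiction (trans (sym selected) (∖-self s c)) λ ()

∖-comm : ∀ s c d i → (s ∖ c ∖ d) i ≡ (s ∖ d ∖ c) i
∖-comm s c d i with s i
... | true = ∧-comm (not (does (i ≟ c))) (not (does (i ≟ d)))
... | false = refl

infixl 5 _↾_
_↾_ : (ℕ → ℕ) → (ℕ → Bool) → (ℕ → ℕ)
(f ↾ s) i = if s i then f i else 1

prod-↾-cong : ∀ r f {s t} → AllUpTo r (λ i → s i ≡ t i) → prod r (f ↾ s) ≡ prod r (f ↾ t)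
prod-↾-cong r f s≗t = prod-cong r λ i 1≤i i≤r → cong (λ b → if b then f i else 1) (s≗t i 1≤i i≤r)

prod-↾-remove : ∀ r f s {c} → 1 ≤ c → c ≤ r → s c ≡ true → prod r (f ↾ s) ≡ f c * prod r (f ↾ s ∖ c)
prod-↾-remove zero f s 1≤c c≤0 sc = contradiction (≤-trans 1≤c c≤0) λ ()
prod-↾-remove (suc r) f s {c} 1≤c c≤1+r sc with suc r ≟ c
... | yes refl = begin
  prod r (f ↾ s) * (f ↾ s) c          ≡⟨ cong₂ _*_ (prod-↾-cong r f λ i _ i≤r → sym (∖-≢ s (<⇒≢ (s≤s i≤r))))
                                                  (cong (λ b → if b then f c else 1) sc) ⟩
  prod r (f ↾ s ∖ c) * f c            ≡⟨ *-comm _ (f c) ⟩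
  f c * prod r (f ↾ s ∖ c)            ≡⟨ cong (f c *_) (*-identityʳ _) ⟨
  f c * (prod r (f ↾ s ∖ c) * 1)      ≡⟨ cong (λ b → f c * (prod r (f ↾ s ∖ c) * (if b then f c else 1)))
                                               (∖-self s c) ⟨
  f c * prod (suc r) (f ↾ s ∖ c)      ∎
  where open ≡-Reasoning
... | no 1+r≢c = begin
  prod r (f ↾ s) * x                  ≡⟨ cong (_* x) (prod-↾-remove r f s 1≤c c≤r sc) ⟩
  f c * prod r (f ↾ s ∖ c) * x        ≡⟨ *-assoc (f c) _ x ⟩
  f c * (prod r (f ↾ s ∖ c) * x)      ≡⟨ cong (λ b → f c * (prod r (f ↾ s ∖ c) * (if b then f (suc r) else 1)))
                                               (∖-≢ s 1+r≢c) ⟨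
  f c * prod (suc r) (f ↾ s ∖ c)      ∎
  where
  open ≡-Reasoning
  x : ℕ
  x = (f ↾ s) (suc r)
  c≤r : c ≤ r
  c≤r = ≤-pred (≤∧≢⇒< c≤1+r (1+r≢c ∘ sym))

prod-↾-only : ∀ r f {c} → 1 ≤ c → c ≤ r → prod r (f ↾ only c) ≡ f c
prod-↾-only r f {c} 1≤c c≤r = begin
  prod r (f ↾ only c)           ≡⟨ prod-↾-remove r f (only c) 1≤c c≤r (dec-true (c ≟ c) refl) ⟩
  f c * prod r (f ↾ only c ∖ c) ≡⟨ cong (f c *_) (trans (prod-cong r λ i _ _ → off i) (prod-1 r)) ⟩
  f c * 1                       ≡⟨ *-identityʳ (f c) ⟩
  f c                           ∎
  where
  open ≡-Reasoning
  off : ∀ i → (f ↾ only c ∖ c) i ≡ 1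
  off i = cong (λ b → if b then f i else 1) (∧-inverseʳ (does (i ≟ c)))
  prod-1 : ∀ r → prod r (λ _ → 1) ≡ 1
  prod-1 zero = refl
  prod-1 (suc r) = cong (_* 1) (prod-1 r)

-- Sieving by distinct primes

coprime-* : ∀ {m n z} → Coprime m z → Coprime n z → Coprime (m * n) z
coprime-* {m} m⊥z n⊥z (d∣mn , d∣z) = n⊥z (coprime-divisor d⊥m d∣mn , d∣z)
  where
  d⊥m : Coprime _ m
  d⊥m (c∣d , c∣m) = m⊥z (c∣m , ∣-trans c∣d d∣z)

coprime-prod : ∀ r {f z} → AllUpTo r (λ i → Coprime (f i) z) → Coprime (prod r f) z
coprime-prod zero f⊥z = 1-coprimeTo _
coprime-prod (suc r) f⊥z = coprime-* (coprime-prod r (AllUpTo-pred f⊥z)) (f⊥z (suc r) (s≤s z≤n) ≤-refl)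

prime∤⇒coprime : ∀ {q z} → Prime q → ¬ q ∣ z → Coprime q z
prime∤⇒coprime q-prime q∤z (d∣q , d∣z) with prime⇒irreducible q-prime d∣q
... | inj₁ d≡1 = d≡1
... | inj₂ refl = contradiction d∣z q∤z

prime∤⇒coprime-^ : ∀ {q z} → Prime q → ¬ q ∣ z → ∀ c → Coprime (q ^ c) z
prime∤⇒coprime-^ q-prime q∤z zero = 1-coprimeTo _
prime∤⇒coprime-^ q-prime q∤z (suc c) = coprime-* (prime∤⇒coprime q-prime q∤z) (prime∤⇒coprime-^ q-prime q∤z c)

prime∤-∣ᵇ-* : ∀ {P q} z → Prime P → ¬ P ∣ q → P ∣ᵇ (q * z) ≡ P ∣ᵇ z
prime∤-∣ᵇ-* {P} {q} z P-prime P∤q = does-⇔ (mk⇔ cancel (∣n⇒∣m*n q)) (P ∣? (q * z)) (P ∣? z)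
  where
  cancel : P ∣ q * z → P ∣ z
  cancel P∣qz with euclidsLemma q z P-prime P∣qz
  ... | inj₁ P∣q = contradiction P∣q P∤q
  ... | inj₂ P∣z = P∣z

positive : ℕ → Bool
positive zero = false
positive (suc _) = true

≥1⇒positive : ∀ {m} → 1 ≤ m → positive m ≡ true
≥1⇒positive {suc m} _ = refl

φ^ : ℕ → ℕ → ℕ
φ^ q zero = 1
φ^ q (suc c) = q ^ c * pred q

φ^[1+k]≤φ^[k]*q : ∀ q k → φ^ q (suc k) ≤ φ^ q k * q
φ^[1+k]≤φ^[k]*q q zero = *-monoʳ-≤ 1 pred[n]≤n
φ^[1+k]≤φ^[k]*q q (suc k) = ≤-reflexive (rotate q (q ^ k) (pred q))
  where
  rotate : ∀ a b c → a * b * c ≡ b * c * a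
  rotate = solve-∀

module Sieve (p : ℕ → ℕ) (r : ℕ) (p-prime : AllUpTo r (Prime ∘ p))
  (p-injective : ∀ {i j} → 1 ≤ i → i ≤ r → 1 ≤ j → j ≤ r → p i ≡ p j → i ≡ j) where

  2≤p : ∀ {i} → 1 ≤ i → i ≤ r → 2 ≤ p i
  2≤p {i} 1≤i i≤r = nonTrivial⇒n>1 (p i) {{prime⇒nonTrivial (p-prime i 1≤i i≤r)}}

  p≢0 : ∀ {i} → 1 ≤ i → i ≤ r → NonZero (p i)
  p≢0 1≤i i≤r = prime⇒nonZero (p-prime _ 1≤i i≤r)

  p∤p : ∀ {i j} → 1 ≤ i → i ≤ r → 1 ≤ j → j ≤ r → i ≢ j → ¬ p i ∣ p j
  p∤p 1≤i i≤r 1≤j j≤r i≢j pi∣pj with prime⇒irreducible (p-prime _ 1≤j j≤r) pi∣pj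
  ... | inj₁ pi≡1 = <⇒≢ (2≤p 1≤i i≤r) (sym pi≡1)
  ... | inj₂ pi≡pj = i≢j (p-injective 1≤i i≤r 1≤j j≤r pi≡pj)

  p*p∣ : ∀ {i j m} → 1 ≤ i → i ≤ r → 1 ≤ j → j ≤ r → i ≢ j → p i ∣ m → p j ∣ m → p i * p j ∣ m
  p*p∣ {i} {j} 1≤i i≤r 1≤j j≤r i≢j (divides t refl) pj∣t*pi
    with divides u refl ← coprime-divisor
                            (prime∤⇒coprime (p-prime j 1≤j j≤r) (p∤p 1≤j j≤r 1≤i i≤r (i≢j ∘ sym)))
                            (subst (p j ∣_) (*-comm t (p i)) pj∣t*pi)
    = divides u (trans (*-assoc u (p j) (p i)) (cong (u *_) (*-comm (p j) (p i))))

  survives : (ℕ → Bool) → ℕ → ℕ → Bool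
  survives s zero y = true
  survives s (suc k) y = survives s k y ∧ not (s (suc k) ∧ p (suc k) ∣ᵇ y)

  survives-false⇒ : ∀ s k y → survives s k y ≡ false → ∃ λ i → 1 ≤ i × i ≤ k × s i ≡ true × p i ∣ y
  survives-false⇒ s (suc k) y dead with survives s k y in dead-before | s (suc k) in selected | p (suc k) ∣? y
  ... | false | _ | _ with i , 1≤i , i≤k , si , pi∣y ← survives-false⇒ s k y dead-before =
    i , 1≤i , m≤n⇒m≤1+n i≤k , si , pi∣y
  ... | true | true | yes pk∣y = suc k , s≤s z≤n , ≤-refl , selected , pk∣y

  survives⇒∤ : ∀ s k y → survives s k y ≡ true → ∀ {i} → 1 ≤ i → i ≤ k → s i ≡ true → ¬ p i ∣ y
  survives⇒∤ s zero y alive 1≤i i≤0 = contradiction (≤-trans 1≤i i≤0) λ ()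
  survives⇒∤ s (suc k) y alive {i} 1≤i i≤1+k si pi∣y with survives s k y in alive-before | i ≟ suc k
  ... | true | no i≢1+k = survives⇒∤ s k y alive-before 1≤i (≤-pred (≤∧≢⇒< i≤1+k i≢1+k)) si pi∣y
  ... | true | yes refl with s i | p i ∣? y
  ...   | true | no pi∤y = pi∤y pi∣y

  ∣⇒survives-false : ∀ s k {y i} → 1 ≤ i → i ≤ k → s i ≡ true → p i ∣ y → survives s k y ≡ false
  ∣⇒survives-false s k {y} 1≤i i≤k si pi∣y with survives s k y in alive
  ... | true = contradiction pi∣y (survives⇒∤ s k y alive 1≤i i≤k si)
  ... | false = refl

  survives-* : ∀ s k q z → k ≤ r → (∀ {i} → 1 ≤ i → i ≤ k → s i ≡ true → ¬ p i ∣ q) →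
    survives s k (q * z) ≡ survives s k z
  survives-* s zero q z _ _ = refl
  survives-* s (suc k) q z 1+k≤r q-coprime with s (suc k) in selected
  ... | false = cong (_∧ true) (survives-* s k q z (<⇒≤ 1+k≤r) (λ 1≤i i≤k → q-coprime 1≤i (m≤n⇒m≤1+n i≤k)))
  ... | true = cong₂ (λ alive d → alive ∧ not d)
    (survives-* s k q z (<⇒≤ 1+k≤r) (λ 1≤i i≤k → q-coprime 1≤i (m≤n⇒m≤1+n i≤k)))
    (prime∤-∣ᵇ-* z (p-prime (suc k) (s≤s z≤n) 1+k≤r) (q-coprime (s≤s z≤n) ≤-refl selected))

  count-survivors : ∀ s k → k ≤ r → ∀ M → count (survives s k) (M * prod k (p ↾ s)) ≡ M * prod k (pred ∘ p ↾ s)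
  count-survivors s zero _ M = count-all (M * 1)
  count-survivors s (suc k) 1+k≤r M with s (suc k) in selected
  ... | false = begin
    count (λ y → survives s k y ∧ true) (M * (P * 1)) ≡⟨ count-cong (∧-identityʳ ∘ survives s k) (M * (P * 1)) ⟩
    count (survives s k) (M * (P * 1))               ≡⟨ cong (λ t → count (survives s k) (M * t)) (*-identityʳ P) ⟩
    count (survives s k) (M * P)                     ≡⟨ count-survivors s k k≤r M ⟩
    M * Φ                                            ≡⟨ cong (M *_) (*-identityʳ Φ) ⟨
    M * (Φ * 1)                                      ∎
    where
    open ≡-Reasoning
    k≤r : k ≤ r
    k≤r = <⇒≤ 1+k≤r
    P Φ : ℕ
    P = prod k (p ↾ s)
    Φ = prod k (pred ∘ p ↾ s)
  ... | true = +-cancelʳ-≡ _ _ _ (begin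
    count new segment + M * Φ                          ≡⟨ cong (count new segment +_) old-divisible ⟨
    count new segment + count (λ y → g y ∧ q ∣ᵇ y) segment ≡⟨ count-split g (q ∣ᵇ_) segment ⟩
    count g segment                                    ≡⟨ cong (count g) (trans (reassoc M P q) (sym (*-assoc q M P))) ⟩
    count g (q * M * P)                              ≡⟨ count-survivors s k k≤r (q * M) ⟩
    q * M * Φ                                        ≡⟨ cong (λ t → t * M * Φ) (suc-pred q) ⟨
    suc (pred q) * M * Φ                             ≡⟨ peel (pred q) M Φ ⟩
    M * (Φ * pred q) + M * Φ                         ∎)
    where
    open ≡-Reasoning
    k≤r : k ≤ r
    k≤r = <⇒≤ 1+k≤r
    g : ℕ → Bool
    g = survives s k
    q P Φ segment : ℕ
    q = p (suc k)
    P = prod k (p ↾ s)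
    Φ = prod k (pred ∘ p ↾ s)
    segment = M * (P * q)
    new : ℕ → Bool
    new y = g y ∧ not (q ∣ᵇ y)
    instance
      q≢0 : NonZero q
      q≢0 = p≢0 (s≤s z≤n) 1+k≤r
    reassoc : ∀ M P q → M * (P * q) ≡ q * (M * P)
    reassoc = solve-∀
    peel : ∀ q′ M Φ → suc q′ * M * Φ ≡ M * (Φ * q′) + M * Φ
    peel = solve-∀
    q-coprime : ∀ {i} → 1 ≤ i → i ≤ k → s i ≡ true → ¬ p i ∣ q
    q-coprime 1≤i i≤k _ = p∤p 1≤i (≤-trans i≤k k≤r) (s≤s z≤n) 1+k≤r (λ { refl → 1+n≰n i≤k })
    old-divisible : count (λ y → g y ∧ q ∣ᵇ y) segment ≡ M * Φ
    old-divisible = begin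
      count (λ y → g y ∧ q ∣ᵇ y) segment         ≡⟨ count-cong (λ y → ∧-comm (g y) (q ∣ᵇ y)) segment ⟩
      count (λ y → q ∣ᵇ y ∧ g y) segment         ≡⟨ cong (count _) (reassoc M P q) ⟩
      count (λ y → q ∣ᵇ y ∧ g y) (q * (M * P)) ≡⟨ count-multiples q g (M * P) ⟩
      count (λ z → g (q * z)) (M * P)          ≡⟨ count-cong (λ z → survives-* s k q z k≤r q-coprime) (M * P) ⟩
      count g (M * P)                          ≡⟨ count-survivors s k k≤r M ⟩
      M * Φ                                    ∎

  count-multiples-not-surviving : ∀ s q .{{_ : NonZero q}} M →
    (∀ {i} → 1 ≤ i → i ≤ r → s i ≡ true → ¬ p i ∣ q) →
    count (λ y → q ∣ᵇ y ∧ not (survives s r y)) (q * (M * prod r (p ↾ s))) + M * prod r (pred ∘ p ↾ s)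
      ≡ M * prod r (p ↾ s)
  count-multiples-not-surviving s q M q-coprime = begin
    count (λ y → q ∣ᵇ y ∧ not (survives s r y)) (q * X) + M * prod r (pred ∘ p ↾ s)
      ≡⟨ cong₂ _+_ (count-multiples q (not ∘ survives s r) X) (sym (count-survivors s r ≤-refl M)) ⟩
    count (λ z → not (survives s r (q * z))) X + count (survives s r) X
      ≡⟨ cong (_+ count (survives s r) X) (count-cong (λ z → cong not (survives-* s r q z ≤-refl q-coprime)) X) ⟩
    count (not ∘ survives s r) X + count (survives s r) X
      ≡⟨ +-comm _ (count (survives s r) X) ⟩
    count (survives s r) X + count (not ∘ survives s r) X
      ≡⟨ count-complement (survives s r) X ⟩
    X ∎
    where
    open ≡-Reasoning
    X : ℕ
    X = M * prod r (p ↾ s)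

  1≤prod-pred : ∀ s → 1 ≤ prod r (pred ∘ p ↾ s)
  1≤prod-pred s = >-nonZero⁻¹ _ {{prod-nonZero r factor≢0}}
    where
    factor≢0 : AllUpTo r (λ i → NonZero ((pred ∘ p ↾ s) i))
    factor≢0 i 1≤i i≤r with s i
    ... | true = >-nonZero (pred-mono-≤ (2≤p 1≤i i≤r))
    ... | false = _

  prod-pred≤prod : ∀ s → prod r (pred ∘ p ↾ s) ≤ prod r (p ↾ s)
  prod-pred≤prod s = prod-mono-≤ r λ i _ _ → factor≤ i
    where
    factor≤ : ∀ i → (pred ∘ p ↾ s) i ≤ (p ↾ s) i
    factor≤ i with s i
    ... | true = pred[n]≤n
    ... | false = ≤-refl

  power totient : (ℕ → ℕ) → ℕ
  power c = prod r (λ i → p i ^ c i)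
  totient c = prod r (λ i → φ^ (p i) (c i))

  support : (ℕ → ℕ) → ℕ → Bool
  support c i = positive (c i)

  power-split : ∀ c → power c ≡ prod r (λ i → p i ^ pred (c i)) * prod r (p ↾ support c)
  power-split c = prod-split r _ _ λ i _ _ → split i
    where
    split : ∀ i → p i ^ c i ≡ p i ^ pred (c i) * (p ↾ support c) i
    split i with c i
    ... | zero = refl
    ... | suc c′ = *-comm (p i) (p i ^ c′)

  totient-split : ∀ c → totient c ≡ prod r (λ i → p i ^ pred (c i)) * prod r (pred ∘ p ↾ support c)
  totient-split c = prod-split r _ _ λ i _ _ → split i
    where
    split : ∀ i → φ^ (p i) (c i) ≡ p i ^ pred (c i) * (pred ∘ p ↾ support c) i
    split i with c i
    ... | zero = refl
    ... | suc c′ = refl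

  count-coprime-power : ∀ c → count (survives (support c) r) (power c) ≡ totient c
  count-coprime-power c = begin
    count (survives (support c) r) (power c)             ≡⟨ cong (count _) (power-split c) ⟩
    count (survives (support c) r) (M * prod r (p ↾ support c)) ≡⟨ count-survivors (support c) r ≤-refl M ⟩
    M * prod r (pred ∘ p ↾ support c)                    ≡⟨ totient-split c ⟨
    totient c                                            ∎
    where
    open ≡-Reasoning
    M : ℕ
    M = prod r (λ i → p i ^ pred (c i))

  survivor-coprime-power : ∀ c {z} → survives (support c) r z ≡ true → Coprime (power c) z
  survivor-coprime-power c {z} alive = coprime-prod r coprime
    where
    coprime : AllUpTo r (λ i → Coprime (p i ^ c i) z)
    coprime i 1≤i i≤r with c i in ci
    ... | zero = 1-coprimeTo z
    ... | suc c′ = prime∤⇒coprime-^ (p-prime i 1≤i i≤r)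
                     (survives⇒∤ (support c) r z alive 1≤i i≤r (cong positive ci)) (suc c′)

-- Orders of elements of ℤ/nℤ

*-div : ∀ m n .{{_ : NonZero n}} → (m * n) div n ≡ m
*-div m (suc n) = m*n/n≡m m (suc n)

div-* : ∀ {n d} .{{_ : NonZero n}} → d ∣ n → (n div d) * d ≡ n
div-* {d = zero} (divides q refl) = contradiction (*-zeroʳ q) (≢-nonZero⁻¹ (q * 0))
div-* {d = suc d} (divides q refl) = cong (_* suc d) (m*n/n≡m q (suc d))

n∣n/d*y⇔d∣y : ∀ {n d} y .{{_ : NonZero n}} → d ∣ n → n ∣ (n div d) * y ⇔ d ∣ y
n∣n/d*y⇔d∣y {n} {d} y d∣n = mk⇔
  (λ n∣n/d*y → *-cancelˡ-∣ (n div d) {{n/d≢0}} (subst (_∣ (n div d) * y) (sym (div-* d∣n)) n∣n/d*y))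
  (λ d∣y → subst (_∣ (n div d) * y) (div-* d∣n) (*-monoʳ-∣ (n div d) d∣y))
  where
  n/d≢0 : NonZero (n div d)
  n/d≢0 = ≢-nonZero λ n/d≡0 → ≢-nonZero⁻¹ n (trans (sym (div-* d∣n)) (cong (_* d) n/d≡0))

least-≡ : ∀ f s m (P : ℕ → Bool) → s ≤ m → m ≤ s + f → P m ≡ true →
  (∀ k → s ≤ k → k < m → P k ≡ false) → least f s P ≡ m
least-≡ zero s m P s≤m m≤s+0 _ _ = ≤-antisym s≤m (subst (m ≤_) (+-identityʳ s) m≤s+0)
least-≡ (suc f) s m P s≤m m≤s+1+f Pm below with m≤n⇒m<n∨m≡n s≤m
... | inj₂ refl rewrite Pm = refl
... | inj₁ s<m rewrite below s ≤-refl s<m =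
  least-≡ f (suc s) m P s<m (subst (m ≤_) (+-suc s f) m≤s+1+f) Pm (λ k s<k k<m → below k (<⇒≤ s<k) k<m)

ord-of-multiple : ∀ {n} N u (x : Fin n) z .{{_ : NonZero N}} .{{_ : NonZero u}} →
  n ≡ N * u → toℕ x ≡ z * u → Coprime N z → ord n x ≡ N
ord-of-multiple {n} N u x z n≡N*u x≡z*u N⊥z =
  least-≡ n 1 N _ (>-nonZero⁻¹ N) N≤1+n (dec-true (n ∣? (N * toℕ x)) n∣N*x) λ k 1≤k k<N →
    dec-false (n ∣? (k * toℕ x)) (n∤k*x k {{>-nonZero 1≤k}} k<N)
  where
  N≤1+n : N ≤ 1 + n
  N≤1+n = ≤-trans (m≤m*n N u) (≤-trans (≤-reflexive (sym n≡N*u)) (n≤1+n n))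
  n∣N*x : n ∣ N * toℕ x
  n∣N*x = divides z (begin
    N * toℕ x   ≡⟨ cong (N *_) x≡z*u ⟩
    N * (z * u) ≡⟨ x∙yz≈y∙xz N z u ⟩
    z * (N * u) ≡⟨ cong (z *_) n≡N*u ⟨
    z * n       ∎)
    where open ≡-Reasoning
  n∤k*x : ∀ k .{{_ : NonZero k}} → k < N → ¬ n ∣ k * toℕ x
  n∤k*x k k<N n∣k*x = <⇒≱ k<N (∣⇒≤ (coprime-divisor N⊥z (*-cancelʳ-∣ u N*u∣z*k*u)))
    where
    N*u∣z*k*u : N * u ∣ z * k * u
    N*u∣z*k*u = subst₂ _∣_ n≡N*u (trans (cong (k *_) x≡z*u) (x∙yz≈yx∙z k z u)) n∣k*x

-- The polynomial inequality

<-of-+ : ∀ {l r x z} → r + x ≡ l + z → x < z → l < r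
<-of-+ {l} {r} {x} eq x<z = +-cancelʳ-< x l r (subst (l + x <_) (sym eq) (+-monoʳ-< l x<z))

m<pred[m]*pred[n]-of-m<n : ∀ {m n} → 2 ≤ m → m < n → 4 ≤ n → m < pred m * pred n
m<pred[m]*pred[n]-of-m<n {suc zero} (s≤s ()) _ _
m<pred[m]*pred[n]-of-m<n {suc (suc zero)} {suc n′} _ _ (s≤s 3≤n′) =
  ≤-trans 3≤n′ (≤-reflexive (sym (+-identityʳ n′)))
m<pred[m]*pred[n]-of-m<n {suc (suc (suc m″))} {suc n′} _ (s≤s m≤n′) _ = begin
  suc (suc m′)  ≡⟨ +-comm 1 (suc m′) ⟩
  suc m′ + 1    ≤⟨ +-mono-≤ m≤n′ (≤-trans (s≤s z≤n) m≤n′) ⟩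
  n′ + n′       ≡⟨ cong (n′ +_) (+-identityʳ n′) ⟨
  2 * n′        ≤⟨ *-monoˡ-≤ n′ {2} {m′} (s≤s (s≤s z≤n)) ⟩
  m′ * n′       ∎
  where
  open ≤-Reasoning
  m′ : ℕ
  m′ = suc (suc m″)

m<pred[m]*pred[n]-of-n<m : ∀ {m n} → 3 ≤ n → n < m → m < pred m * pred n
m<pred[m]*pred[n]-of-n<m {suc m′} {suc n′} (s≤s 2≤n′) (s≤s n≤m′) = begin
  2 + m′   ≤⟨ +-monoˡ-≤ m′ (≤-trans 2≤n′ (≤-trans (n≤1+n n′) n≤m′)) ⟩
  m′ + m′  ≡⟨ cong (m′ +_) (*-identityʳ m′) ⟨
  m′ + m′ * 1 ≡⟨ *-suc m′ 1 ⟨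
  m′ * 2   ≤⟨ *-monoʳ-≤ m′ 2≤n′ ⟩
  m′ * n′  ∎
  where open ≤-Reasoning

-- With u = p_a, v = p_b, w = p_r these are p_a |Q_r^1| < p_a (|E_{n/p_a}| + |T|) divided by K, with the
-- subtractions moved across (see combine-bounds); Π and Φ are the products of p_i and of p_i − 1 over the
-- remaining indices. Each identity reads RHS + c u = LHS + (non-negative terms) + c X with c > 0 and u < X.
key-ineq-distinct : ∀ u v w {P₁ Φ₁ P₂ Φ₂ G Π Φ} →
  P₁ ≡ u * (v * Π) → Φ₁ ≡ pred u * (pred v * Φ) → P₂ ≡ w * Π → Φ₂ ≡ pred w * Φ →
  G ≡ pred v * (pred w * Φ) →
  2 ≤ v → v ≤ w → u < pred u * pred w → 1 ≤ Φ → Φ ≤ Π →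
  u * P₁ + u * u * Φ₂ < pred u * G + u * u * P₂ + u * Φ₁
key-ineq-distinct (suc U) (suc V) _ {Φ = Φ} refl refl refl refl refl (s≤s 1≤V) v≤w u<UW 1≤Φ Φ≤Π
  with T , refl ← m≤n⇒∃[o]m+o≡n v≤w | Δ , refl ← m≤n⇒∃[o]m+o≡n Φ≤Π =
  ≤-<-trans (m≤m+n _ _) (<-of-+ (identity U V T Φ Δ) (*-monoʳ-< (V * Φ) {{V*Φ≢0}} u<UW))
  where
  V*Φ≢0 : NonZero (V * Φ)
  V*Φ≢0 = m*n≢0 V Φ {{>-nonZero 1≤V}} {{>-nonZero 1≤Φ}}
  identity : ∀ U V T Φ Δ →
    U * (V * ((V + T) * Φ)) + suc U * suc U * (suc (V + T) * (Φ + Δ)) + suc U * (U * (V * Φ)) + V * Φ * suc U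
      ≡ suc U * (suc U * (suc V * (Φ + Δ))) + suc U * suc U * ((V + T) * Φ) + suc U * suc U * T * Δ
        + V * Φ * (U * (V + T))
  identity = solve-∀

key-ineq-a≡r : ∀ u v {P₁ Φ₁ P₂ Φ₂ G Π Φ} →
  P₁ ≡ v * Π → Φ₁ ≡ pred v * Φ → P₂ ≡ Π → Φ₂ ≡ Φ → G ≡ pred v * Φ →
  1 ≤ v → v ≤ u → u < pred u * pred v → 1 ≤ Φ → Φ ≤ Π →
  u * P₁ + u * u * Φ₂ < pred u * G + u * u * P₂ + u * Φ₁
key-ineq-a≡r _ (suc V) {Φ = Φ} refl refl refl refl refl _ v≤u u<UV 1≤Φ Φ≤Π
  with T , refl ← m≤n⇒∃[o]m+o≡n v≤u | Δ , refl ← m≤n⇒∃[o]m+o≡n Φ≤Π =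
  ≤-<-trans (m≤m+n _ _) (<-of-+ (identity V T Φ Δ) (*-monoʳ-< Φ {{>-nonZero 1≤Φ}} u<UV))
  where
  identity : ∀ V T Φ Δ →
    (V + T) * (V * Φ) + suc (V + T) * suc (V + T) * (Φ + Δ) + suc (V + T) * (V * Φ) + Φ * suc (V + T)
      ≡ suc (V + T) * (suc V * (Φ + Δ)) + suc (V + T) * suc (V + T) * Φ + suc (V + T) * T * Δ
        + Φ * ((V + T) * V)
  identity = solve-∀

key-ineq-b≡r : ∀ u w {P₁ Φ₁ P₂ Φ₂ G Π Φ} →
  P₁ ≡ u * Π → Φ₁ ≡ pred u * Φ → P₂ ≡ Π → Φ₂ ≡ Φ → G ≡ pred w * Φ →
  u < pred u * pred w → 1 ≤ Φ →
  u * P₁ + u * u * Φ₂ < pred u * G + u * u * P₂ + u * Φ₁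
key-ineq-b≡r (suc U) w {Π = Π} {Φ} refl refl refl refl refl u<UW 1≤Φ =
  <-of-+ (identity U (pred w) Π Φ) (*-monoʳ-< Φ {{>-nonZero 1≤Φ}} u<UW)
  where
  identity : ∀ U W Π Φ →
    U * (W * Φ) + suc U * suc U * Π + suc U * (U * Φ) + Φ * suc U
      ≡ suc U * (suc U * Π) + suc U * suc U * Φ + Φ * (U * W)
  identity = solve-∀

combine-bounds : ∀ u K {X Y Z P₁ Φ₁ P₂ Φ₂ G} .{{_ : NonZero K}} →
  X + K * Φ₁ ≡ K * P₁ → Y + K * u * Φ₂ ≡ K * u * P₂ → K * (pred u * G) ≤ u * Z →
  u * P₁ + u * u * Φ₂ < pred u * G + u * u * P₂ + u * Φ₁ → u * X < u * (Z + Y)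
combine-bounds u K {X} {Y} {Z} {P₁} {Φ₁} {P₂} {Φ₂} {G} X-eq Y-eq Z-bound key =
  +-cancelʳ-< C (u * X) (u * (Z + Y)) (begin-strict
    u * X + C                                          ≡⟨ expand-X u X K Φ₁ Φ₂ ⟩
    u * (X + K * Φ₁) + u * (K * u * Φ₂)                ≡⟨ cong (λ t → u * t + u * (K * u * Φ₂)) X-eq ⟩
    u * (K * P₁) + u * (K * u * Φ₂)                    ≡⟨ factor-K u K P₁ Φ₂ ⟩
    K * (u * P₁ + u * u * Φ₂)                          <⟨ *-monoʳ-< K key ⟩
    K * (pred u * G + u * u * P₂ + u * Φ₁)             ≡⟨ distribute-K u K (pred u * G) P₂ Φ₁ ⟩
    K * (pred u * G) + u * (K * u * P₂) + u * (K * Φ₁) ≤⟨ +-monoˡ-≤ (u * (K * Φ₁))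
                                                              (+-monoˡ-≤ (u * (K * u * P₂)) Z-bound) ⟩
    u * Z + u * (K * u * P₂) + u * (K * Φ₁)            ≡⟨ cong (λ t → u * Z + u * t + u * (K * Φ₁)) Y-eq ⟨
    u * Z + u * (Y + K * u * Φ₂) + u * (K * Φ₁)        ≡⟨ expand-Y u Z Y K Φ₁ Φ₂ ⟩
    u * (Z + Y) + C                                    ∎)
  where
  open ≤-Reasoning
  C : ℕ
  C = u * (K * Φ₁) + u * (K * u * Φ₂)
  expand-X : ∀ u X K Φ₁ Φ₂ → u * X + (u * (K * Φ₁) + u * (K * u * Φ₂)) ≡ u * (X + K * Φ₁) + u * (K * u * Φ₂)
  expand-X = solve-∀
  factor-K : ∀ u K P₁ Φ₂ → u * (K * P₁) + u * (K * u * Φ₂) ≡ K * (u * P₁ + u * u * Φ₂)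
  factor-K = solve-∀
  distribute-K : ∀ u K G P₂ Φ₁ → K * (G + u * u * P₂ + u * Φ₁) ≡ K * G + u * (K * u * P₂) + u * (K * Φ₁)
  distribute-K = solve-∀
  expand-Y : ∀ u Z Y K Φ₁ Φ₂ →
    u * Z + u * (Y + K * u * Φ₂) + u * (K * Φ₁) ≡ u * (Z + Y) + (u * (K * Φ₁) + u * (K * u * Φ₂))
  expand-Y = solve-∀

-- The counting argument

increasing⇒injective : ∀ r {p : ℕ → ℕ} → (∀ i j → 1 ≤ i → i < j → j ≤ r → p i < p j) →
  ∀ {i j} → 1 ≤ i → i ≤ r → 1 ≤ j → j ≤ r → p i ≡ p j → i ≡ j
increasing⇒injective r increasing {i} {j} 1≤i i≤r 1≤j j≤r pi≡pj with <-cmp i j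
... | tri< i<j _ _ = contradiction pi≡pj (<⇒≢ (increasing i j 1≤i i<j j≤r))
... | tri≈ _ i≡j _ = i≡j
... | tri> _ _ j<i = contradiction (sym pi≡pj) (<⇒≢ (increasing j i 1≤j j<i i≤r))

^-pred : ∀ m {k} → 1 ≤ k → m ^ k ≡ m ^ pred k * m
^-pred m {suc k} _ = *-comm m (m ^ k)

<∸1⇒suc< : ∀ {j} r → j < r ∸ 1 → suc j < r
<∸1⇒suc< (suc r) j<r = s<s j<r

module Setting (r : ℕ) (p e : ℕ → ℕ) (a b : ℕ) (3≤r : 3 ≤ r) (p-prime : AllUpTo r (Prime ∘ p))
  (p-increasing : ∀ i j → 1 ≤ i → i < j → j ≤ r → p i < p j) (e-positive : AllUpTo r (λ i → 1 ≤ e i))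
  (1≤a : 1 ≤ a) (a≤r : a ≤ r) (1≤b : 1 ≤ b) (b≤r : b ≤ r) (a≢b : a ≢ b) (2<p[b] : 2 < p b) where

  open Sieve p r p-prime (increasing⇒injective r p-increasing)

  1≤r : 1 ≤ r
  1≤r = ≤-trans (s≤s z≤n) 3≤r

  4≤p[r] : 4 ≤ p r
  4≤p[r] with k , refl ← m≤n⇒∃[o]m+o≡n 3≤r =
    ≤-trans (s≤s 3≤p[2+k]) (p-increasing (2 + k) (3 + k) (s≤s z≤n) ≤-refl ≤-refl)
    where
    3≤p[2+k] : 3 ≤ p (2 + k)
    3≤p[2+k] = ≤-trans (s≤s (2≤p (s≤s z≤n) (≤-trans (n≤1+n (1 + k)) (n≤1+n (2 + k)))))
                       (p-increasing (1 + k) (2 + k) (s≤s z≤n) ≤-refl (n≤1+n _))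

  n K u : ℕ
  n = power e
  K = prod r (λ i → p i ^ pred (e i))
  u = p a

  instance
    n≢0 : NonZero n
    n≢0 = prod-nonZero r λ i 1≤i i≤r → m^n≢0 (p i) (e i) {{p≢0 1≤i i≤r}}
    K≢0 : NonZero K
    K≢0 = prod-nonZero r λ i 1≤i i≤r → m^n≢0 (p i) (pred (e i)) {{p≢0 1≤i i≤r}}
    u≢0 : NonZero u
    u≢0 = p≢0 1≤a a≤r

  n≡K*rad : n ≡ K * prod r p
  n≡K*rad = trans (power-split e) (cong (K *_) (prod-↾-cong r p λ i 1≤i i≤r → ≥1⇒positive (e-positive i 1≤i i≤r)))

  p∣n : ∀ {i} → 1 ≤ i → i ≤ r → p i ∣ n
  p∣n 1≤i i≤r = subst (p _ ∣_) (sym n≡K*rad) (∣n⇒∣m*n K (∣-prod r p 1≤i i≤r))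

  InS⇔ : ∀ {i j} → 1 ≤ i → i ≤ r → 1 ≤ j → j ≤ r → i ≢ j →
    ∀ x → InS n (n div (p i * p j)) x ⇔ p i * p j ∣ toℕ x
  InS⇔ 1≤i i≤r 1≤j j≤r i≢j x =
    n∣n/d*y⇔d∣y (toℕ x) (p*p∣ 1≤i i≤r 1≤j j≤r i≢j (p∣n 1≤i i≤r) (p∣n 1≤j j≤r))

  P₁ Φ₁ : ℕ
  P₁ = prod r (p ↾ full ∖ r)
  Φ₁ = prod r (pred ∘ p ↾ full ∖ r)

  Q-sieve : ℕ → Bool
  Q-sieve y = p r ∣ᵇ y ∧ not (survives (full ∖ r) r y)

  ∈S⇒Q-sieve : ∀ {i} → 1 ≤ i → i < r → ∀ x → InS n (n div (p i * p r)) x → Q-sieve (toℕ x) ≡ true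
  ∈S⇒Q-sieve {i} 1≤i i<r x x∈S = cong₂ (λ d alive → d ∧ not alive)
    (dec-true (p r ∣? toℕ x) (∣-trans (n∣m*n (p i)) pi*pr∣x))
    (∣⇒survives-false (full ∖ r) r 1≤i (<⇒≤ i<r) (∖-selected full refl (<⇒≢ i<r))
                      (∣-trans (m∣m*n (p r)) pi*pr∣x))
    where
    pi*pr∣x : p i * p r ∣ toℕ x
    pi*pr∣x = Equivalence.to (InS⇔ 1≤i (<⇒≤ i<r) 1≤r ≤-refl (<⇒≢ i<r) x) x∈S

  Q⇒Q-sieve : ∀ x → InUnion n (Qlist n r p) x → Q-sieve (toℕ x) ≡ true
  Q⇒Q-sieve x x∈Q with j , j∈ , x∈S ← find (Any.map⁻ (Any.map⁻ x∈Q)) =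
    ∈S⇒Q-sieve (s≤s z≤n) (<∸1⇒suc< r (∈-upTo⁻ j∈)) x x∈S

  n≡p[r]*K*P₁ : n ≡ p r * (K * P₁)
  n≡p[r]*K*P₁ = begin
    n              ≡⟨ n≡K*rad ⟩
    K * prod r p   ≡⟨ cong (K *_) (prod-↾-remove r p full 1≤r ≤-refl refl) ⟩
    K * (p r * P₁) ≡⟨ x∙yz≈y∙xz K (p r) P₁ ⟩
    p r * (K * P₁) ∎
    where open ≡-Reasoning

  count-Q-sieve : count Q-sieve n + K * Φ₁ ≡ K * P₁
  count-Q-sieve = subst (λ m → count Q-sieve m + K * Φ₁ ≡ K * P₁) (sym n≡p[r]*K*P₁)
    (count-multiples-not-surviving (full ∖ r) (p r) {{p≢0 1≤r ≤-refl}} K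
      λ 1≤i i≤r selected → p∤p 1≤i i≤r 1≤r ≤-refl (∖-selected⇒≢ full r selected))

  P₂ Φ₂ : ℕ
  P₂ = prod r (p ↾ full ∖ a ∖ b)
  Φ₂ = prod r (pred ∘ p ↾ full ∖ a ∖ b)

  T-sieve : ℕ → Bool
  T-sieve y = p b ∣ᵇ y ∧ not (survives (full ∖ a ∖ b) r y)

  p[b]*p[i]∣⇒T : ∀ {i} → i < r → (full ∖ a ∖ b) (suc i) ≡ true → ∀ x → p b * p (suc i) ∣ toℕ x →
    InUnion n (Tlist n r p a b) x
  p[b]*p[i]∣⇒T {i} i<r selected x pb*pi∣x = Any.map⁺ (lose 1+i∈indices x∈S)
    where
    1+i∈indices : suc i ∈ filterᵇ (full ∖ a ∖ b) (map suc (upTo r))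
    1+i∈indices = ∈-filter⁺ (T? ∘ (full ∖ a ∖ b)) (∈-map⁺ suc (∈-upTo⁺ i<r)) (Equivalence.from T-≡ selected)
    x∈S : InS n (n div (p b * p (suc i))) x
    x∈S = Equivalence.from (InS⇔ 1≤b b≤r (s≤s z≤n) i<r (∖-selected⇒≢ (full ∖ a) b selected ∘ sym) x) pb*pi∣x

  T-sieve⇒T : ∀ x → T-sieve (toℕ x) ≡ true → InUnion n (Tlist n r p a b) x
  T-sieve⇒T x in-sieve with p b ∣? toℕ x | survives (full ∖ a ∖ b) r (toℕ x) in dead
  ... | yes pb∣x | false with suc i , _ , i<r , selected , pi∣x ← survives-false⇒ (full ∖ a ∖ b) r (toℕ x) dead =
    p[b]*p[i]∣⇒T i<r selected x
      (p*p∣ 1≤b b≤r (s≤s z≤n) i<r (∖-selected⇒≢ (full ∖ a) b selected ∘ sym) pb∣x pi∣x)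

  n≡p[b]*K*u*P₂ : n ≡ p b * (K * u * P₂)
  n≡p[b]*K*u*P₂ = begin
    n                               ≡⟨ n≡K*rad ⟩
    K * prod r p                    ≡⟨ cong (K *_) (prod-↾-remove r p full 1≤a a≤r refl) ⟩
    K * (u * prod r (p ↾ full ∖ a)) ≡⟨ cong (λ t → K * (u * t))
                                             (prod-↾-remove r p (full ∖ a) 1≤b b≤r b-selected) ⟩
    K * (u * (p b * P₂))            ≡⟨ rearrange K u (p b) P₂ ⟩
    p b * (K * u * P₂)              ∎
    where
    open ≡-Reasoning
    b-selected : (full ∖ a) b ≡ true
    b-selected = ∖-selected full refl (a≢b ∘ sym)
    rearrange : ∀ k u v w → k * (u * (v * w)) ≡ v * (k * u * w)
    rearrange = solve-∀

  count-T-sieve : count T-sieve n + K * u * Φ₂ ≡ K * u * P₂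
  count-T-sieve = subst (λ m → count T-sieve m + K * u * Φ₂ ≡ K * u * P₂) (sym n≡p[b]*K*u*P₂)
    (count-multiples-not-surviving (full ∖ a ∖ b) (p b) {{p≢0 1≤b b≤r}} (K * u)
      λ 1≤i i≤r selected → p∤p 1≤i i≤r 1≤b b≤r (∖-selected⇒≢ (full ∖ a) b selected))

  e⁻ : ℕ → ℕ
  e⁻ i = if only a i then pred (e i) else e i

  N : ℕ
  N = power e⁻

  n≡N*u : n ≡ N * u
  n≡N*u = trans (prod-split r (λ i → p i ^ e⁻ i) (p ↾ only a) factor) (cong (N *_) (prod-↾-only r p 1≤a a≤r))
    where
    factor : AllUpTo r (λ i → p i ^ e i ≡ p i ^ e⁻ i * (p ↾ only a) i)
    factor i 1≤i i≤r with i ≟ a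
    ... | yes refl rewrite dec-true (i ≟ i) refl = ^-pred (p i) (e-positive i 1≤i i≤r)
    ... | no i≢a rewrite dec-false (i ≟ a) i≢a = sym (*-identityʳ _)

  instance
    N≢0 : NonZero N
    N≢0 = m*n≢0⇒m≢0 N {{subst NonZero n≡N*u n≢0}}

  E-sieve : ℕ → Bool
  E-sieve y = u ∣ᵇ y ∧ survives (support e⁻) r (y div u)

  E-sieve⇒E : ∀ x → E-sieve (toℕ x) ≡ true → E n (n div u) x
  E-sieve⇒E x in-sieve with u ∣? toℕ x | survives (support e⁻) r (toℕ x div u) in alive
  ... | yes (divides z x≡z*u) | true = begin
    ord n x       ≡⟨ ord-of-multiple N u x z n≡N*u x≡z*u (survivor-coprime-power e⁻ z-alive) ⟩
    N             ≡⟨ *-div N u ⟨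
    (N * u) div u ≡⟨ cong (_div u) n≡N*u ⟨
    n div u       ∎
    where
    open ≡-Reasoning
    z-alive : survives (support e⁻) r z ≡ true
    z-alive = trans (cong (survives (support e⁻) r) (sym (trans (cong (_div u) x≡z*u) (*-div z u)))) alive

  count-E-sieve : count E-sieve n ≡ totient e⁻
  count-E-sieve = begin
    count E-sieve n                                         ≡⟨ cong (count E-sieve) (trans n≡N*u (*-comm N u)) ⟩
    count E-sieve (u * N)
      ≡⟨ count-multiples u (λ y → survives (support e⁻) r (y div u)) N ⟩
    count (λ z → survives (support e⁻) r ((u * z) div u)) N
      ≡⟨ count-cong (cong (survives (support e⁻) r) ∘ u*z/u≡z) N ⟩
    count (survives (support e⁻) r) N                       ≡⟨ count-coprime-power e⁻ ⟩
    totient e⁻                                              ∎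
    where
    open ≡-Reasoning
    u*z/u≡z : ∀ z → (u * z) div u ≡ z
    u*z/u≡z z = trans (cong (_div u) (*-comm u z)) (*-div z u)

  G : ℕ
  G = prod r (pred ∘ p ↾ full ∖ a)

  totient-e : totient e ≡ K * (pred u * G)
  totient-e = begin
    totient e                          ≡⟨ totient-split e ⟩
    K * prod r (pred ∘ p ↾ support e) ≡⟨ cong (K *_) (prod-↾-cong r (pred ∘ p) λ i 1≤i i≤r →
                                                          ≥1⇒positive (e-positive i 1≤i i≤r)) ⟩
    K * prod r (pred ∘ p)              ≡⟨ cong (K *_) (prod-↾-remove r (pred ∘ p) full 1≤a a≤r refl) ⟩
    K * (pred u * G)                   ∎
    where open ≡-Reasoning

  count-E-sieve-bound : K * (pred u * G) ≤ u * count E-sieve n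
  count-E-sieve-bound = begin
    K * (pred u * G)                                ≡⟨ totient-e ⟨
    totient e                                       ≤⟨ prod-mono-≤ r factor ⟩
    prod r (λ i → φ^ (p i) (e⁻ i) * (p ↾ only a) i) ≡⟨ prod-* r _ _ ⟩
    totient e⁻ * prod r (p ↾ only a)                ≡⟨ cong (totient e⁻ *_) (prod-↾-only r p 1≤a a≤r) ⟩
    totient e⁻ * u                                  ≡⟨ *-comm (totient e⁻) u ⟩
    u * totient e⁻                                  ≡⟨ cong (u *_) count-E-sieve ⟨
    u * count E-sieve n                             ∎
    where
    open ≤-Reasoning
    factor : AllUpTo r (λ i → φ^ (p i) (e i) ≤ φ^ (p i) (e⁻ i) * (p ↾ only a) i)
    factor i 1≤i i≤r with i ≟ a
    ... | no i≢a rewrite dec-false (i ≟ a) i≢a = ≤-reflexive (sym (*-identityʳ _))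
    ... | yes refl rewrite dec-true (i ≟ i) refl with e i | e-positive i 1≤i i≤r
    ...   | suc k | _ = φ^[1+k]≤φ^[k]*q (p i) k

  key-inequality : u * P₁ + u * u * Φ₂ < pred u * G + u * u * P₂ + u * Φ₁
  key-inequality with a ≟ r | b ≟ r
  ... | yes refl | yes refl = contradiction refl a≢b
  ... | no a≢r | no b≢r =
    key-ineq-distinct u (p b) (p r) (remove-a-b p) (remove-a-b (pred ∘ p)) (remove-r p) (remove-r (pred ∘ p))
      (trans (prod-↾-remove r (pred ∘ p) (full ∖ a) 1≤b b≤r (∖-selected full refl (a≢b ∘ sym)))
             (cong (pred (p b) *_) (remove-r (pred ∘ p))))
      (2≤p 1≤b b≤r) (<⇒≤ (p-increasing b r 1≤b b<r ≤-refl))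
      (m<pred[m]*pred[n]-of-m<n (2≤p 1≤a a≤r) (p-increasing a r 1≤a a<r ≤-refl) 4≤p[r])
      (1≤prod-pred (full ∖ a ∖ b ∖ r)) (prod-pred≤prod (full ∖ a ∖ b ∖ r))
    where
    a<r : a < r
    a<r = ≤∧≢⇒< a≤r a≢r
    b<r : b < r
    b<r = ≤∧≢⇒< b≤r b≢r
    remove-a-b : ∀ f → prod r (f ↾ full ∖ r) ≡ f a * (f b * prod r (f ↾ full ∖ a ∖ b ∖ r))
    remove-a-b f = begin
      prod r (f ↾ full ∖ r)
        ≡⟨ prod-↾-remove r f (full ∖ r) 1≤a a≤r (∖-selected full refl a≢r) ⟩
      f a * prod r (f ↾ full ∖ r ∖ a)
        ≡⟨ cong (f a *_) (prod-↾-remove r f (full ∖ r ∖ a) 1≤b b≤r b-selected) ⟩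
      f a * (f b * prod r (f ↾ full ∖ r ∖ a ∖ b))
        ≡⟨ cong (λ t → f a * (f b * t)) (prod-↾-cong r f λ i _ _ → reorder i) ⟩
      f a * (f b * prod r (f ↾ full ∖ a ∖ b ∖ r)) ∎
      where
      open ≡-Reasoning
      b-selected : (full ∖ r ∖ a) b ≡ true
      b-selected = ∖-selected (full ∖ r) (∖-selected full refl b≢r) (a≢b ∘ sym)
      reorder : ∀ i → (full ∖ r ∖ a ∖ b) i ≡ (full ∖ a ∖ b ∖ r) i
      reorder i = trans (cong (_∧ not (does (i ≟ b))) (∖-comm full r a i)) (∖-comm (full ∖ a) r b i)
    remove-r : ∀ f → prod r (f ↾ full ∖ a ∖ b) ≡ f r * prod r (f ↾ full ∖ a ∖ b ∖ r)
    remove-r f = prod-↾-remove r f (full ∖ a ∖ b) 1≤r ≤-refl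
                   (∖-selected (full ∖ a) (∖-selected full refl (a≢r ∘ sym)) (b≢r ∘ sym))
  ... | yes refl | no b≢a =
    key-ineq-a≡r u (p b) (remove-b p) (remove-b (pred ∘ p)) refl refl (remove-b (pred ∘ p))
      (≤-trans (s≤s z≤n) (<⇒≤ 2<p[b])) (<⇒≤ p[b]<p[a]) (m<pred[m]*pred[n]-of-n<m 2<p[b] p[b]<p[a])
      (1≤prod-pred (full ∖ a ∖ b)) (prod-pred≤prod (full ∖ a ∖ b))
    where
    p[b]<p[a] : p b < p a
    p[b]<p[a] = p-increasing b a 1≤b (≤∧≢⇒< b≤r b≢a) ≤-refl
    remove-b : ∀ f → prod r (f ↾ full ∖ a) ≡ f b * prod r (f ↾ full ∖ a ∖ b)
    remove-b f = prod-↾-remove r f (full ∖ a) 1≤b b≤r (∖-selected full refl b≢a)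
  ... | no a≢b′ | yes refl =
    key-ineq-b≡r u (p b) (remove-a p) (remove-a (pred ∘ p)) refl refl
      (prod-↾-remove r (pred ∘ p) (full ∖ a) 1≤b b≤r (∖-selected full refl (a≢b′ ∘ sym)))
      (m<pred[m]*pred[n]-of-m<n (2≤p 1≤a a≤r) (p-increasing a b 1≤a (≤∧≢⇒< a≤r a≢b′) ≤-refl) 4≤p[r])
      (1≤prod-pred (full ∖ a ∖ b))
    where
    remove-a : ∀ f → prod r (f ↾ full ∖ b) ≡ f a * prod r (f ↾ full ∖ a ∖ b)
    remove-a f = trans (prod-↾-remove r f (full ∖ b) 1≤a a≤r (∖-selected full refl a≢b′))
                       (cong (f a *_) (prod-↾-cong r f λ i _ _ → ∖-comm full b a i))

lemma2p5 : (r : ℕ) (p e : ℕ → ℕ) (a b : ℕ) →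
    3 ≤ r →
    (∀ i → 1 ≤ i → i ≤ r → Prime (p i)) →
    (∀ i j → 1 ≤ i → i < j → j ≤ r → p i < p j) →
    (∀ i → 1 ≤ i → i ≤ r → 1 ≤ e i) →
    1 ≤ a → a ≤ r → 1 ≤ b → b ≤ r → a ≢ b → 2 < p b →
    card (prodRange r (λ i → p i ^ e i))
         (E? (prodRange r (λ i → p i ^ e i)) (prodRange r (λ i → p i ^ e i) div p a))
    + card (prodRange r (λ i → p i ^ e i))
         (InUnion? (prodRange r (λ i → p i ^ e i)) (Tlist (prodRange r (λ i → p i ^ e i)) r p a b))
    > card (prodRange r (λ i → p i ^ e i))
         (InUnion? (prodRange r (λ i → p i ^ e i)) (Qlist (prodRange r (λ i → p i ^ e i)) r p))
lemma2p5 r p e a b 3≤r p-prime p-increasing e-positive 1≤a a≤r 1≤b b≤r a≢b 2<p[b]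
  rewrite prodRange≡prod r (λ i → p i ^ e i) = begin-strict
    card n (InUnion? n (Qlist n r p))   ≤⟨ filter-tabulate-≤-count _ _ Q-sieve Q⇒Q-sieve ⟩
    count Q-sieve n                     <⟨ *-cancelˡ-< u _ _ (combine-bounds u K count-Q-sieve count-T-sieve
                                                                count-E-sieve-bound key-inequality) ⟩
    count E-sieve n + count T-sieve n   ≤⟨ +-mono-≤ (count-≤-filter-tabulate _ _ E-sieve E-sieve⇒E)
                                                    (count-≤-filter-tabulate _ _ T-sieve T-sieve⇒T) ⟩
    card n (E? n (n div u)) + card n (InUnion? n (Tlist n r p a b)) ∎
  where
  open Setting r p e a b 3≤r p-prime p-increasing e-positive 1≤a a≤r 1≤b b≤r a≢b 2<p[b]
  open ≤-Reasoning
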